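{- Let $H$ be a hypergraph with no isolated vertices, and let $p\in(0,1)$. Then $b_{L,p}(H)\leq \sum_{e\in E(H)}\lceil p|e|\rceil$ and $b_p(H)\leq 1+\sum_{e\in E(H)}\lceil p|e|\rceil$.
   Context: A hypergraph $H=(V(H),E(H))$ has a finite nonempty vertex set and a finite collection $E(H)$ of subsets of $V(H)$ called edges (parallel edges allowed); a vertex is isolated if it lies in no edge. For a proportion $p\in(0,1)$, the proportion-based propagation rule is: if at the end of a round at least $\lceil p|e|\rceil$ vertices of an edge $e$ are on fire, then in the next round all vertices of $e$ catch fire; burned vertices stay burned. Burning game: let $F_0=\emptyset$ and $F_r$ be the set of burned vertices at the end of round $r$. In each round $r\geq 1$, simultaneously, vertices catch fire by propagation from $F_{r-1}$ (no propagation in round 1), and a player chooses a vertex $u_r\notin F_{r-1}$ (a source) and sets it on fire. A burning sequence is a sequence $(u_1,\ldots,u_k)$ of such sources after which every vertex is on fire at the end of round $k$; $b_p(H)$ is the minimum length of a burning sequence. Lazy game: $S\subseteq V(H)$ is a lazy burning set if, setting all of $S$ on fire at once and then repeatedly applying the propagation rule, every vertex eventually catches fire; $b_{L,p}(H)$ is the minimum size of a lazy burning set.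
   Formalization: The proportion p ranges only over the rational numbers in $(0,1)$. -}

module Defs where

open import Data.Nat using (ℕ; zero; suc; _≤_; _≤ᵇ_)
open import Data.Integer as ℤ using (ℤ; +_)
open import Data.Rational as ℚ using (ℚ; _/_; ceiling; _*_)
open import Data.Fin using (Fin)
open import Data.Fin.Subset using (Subset; ⁅_⁆; _∪_; _∩_; _∈_; _∉_; ∣_∣; ⊤; ⊥)
open import Data.List using (List; []; _∷_; foldr; map; length)
open import Data.Nat.ListAction using (sum)
open import Data.List.Relation.Unary.Any using (Any)
open import Data.Bool using (if_then_else_)
open import Data.Product using (Σ; _×_; ∃)
open import Relation.Binary.PropositionalEquality using (_≡_)

-- A hypergraph on the vertex set Fin n (n ≥ 1, so V(H) is nonempty);
-- edges form a list (so parallel edges are allowed) of subsets of V(H).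
record Hypergraph : Set where
  field
    n        : ℕ
    nonempty : 1 ≤ n
    edges    : List (Subset n)

open Hypergraph public

NoIsolatedVertices : Hypergraph → Set
NoIsolatedVertices H = (v : Fin (n H)) → Any (λ e → v ∈ e) (edges H)

-- ⌈ p * k ⌉  (nonnegative when p > 0, so the absolute value is harmless)
thr : ℚ → ℕ → ℕ
thr p k = ℤ.∣ ceiling (p * ((+ k) / 1)) ∣

ceilSum : (p : ℚ) (H : Hypergraph) → ℕ
ceilSum p H = sum (map (λ e → thr p ∣ e ∣) (edges H))

spread : (p : ℚ) (H : Hypergraph) → Subset (n H) → Subset (n H)
spread p H F =
  F ∪ foldr (λ e acc → if thr p ∣ e ∣ ≤ᵇ ∣ e ∩ F ∣ then e ∪ acc else acc) ⊥ (edges H)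

iterate : {A : Set} → (A → A) → ℕ → A → A
iterate f zero x = x
iterate f (suc k) x = f (iterate f k x)

LazyBurningSet : (p : ℚ) (H : Hypergraph) → Subset (n H) → Set
LazyBurningSet p H S = ∃ λ k → iterate (spread p H) k S ≡ ⊤

LazyBurningNumber≤ : (p : ℚ) (H : Hypergraph) → ℕ → Set
LazyBurningNumber≤ p H m = Σ (Subset (n H)) λ S → LazyBurningSet p H S × ∣ S ∣ ≤ m

-- Rounds r ≥ 2 of the burning game: F = F_{r-1}; the source u_r must be
-- unburned; F_r = (propagation from F_{r-1}) ∪ {u_r}.
-- When the sources run out, everything must be on fire.
GameFrom : (p : ℚ) (H : Hypergraph) → Subset (n H) → List (Fin (n H)) → Set
GameFrom p H F [] = F ≡ ⊤
GameFrom p H F (u ∷ us) = u ∉ F × GameFrom p H (spread p H F ∪ ⁅ u ⁆) us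

-- A burning sequence (u_1, …, u_k).  F_0 = ∅; round 1 has no propagation,
-- so F_1 = {u_1} (and u_1 ∉ F_0 = ∅ holds automatically).
BurningSequence : (p : ℚ) (H : Hypergraph) → List (Fin (n H)) → Set
BurningSequence p H [] = ⊥ {n H} ≡ ⊤
BurningSequence p H (u ∷ us) = GameFrom p H ⁅ u ⁆ us

BurningNumber≤ : (p : ℚ) (H : Hypergraph) → ℕ → Set
BurningNumber≤ p H m = Σ (List (Fin (n H))) λ us → BurningSequence p H us × length us ≤ m

-- Pick ⌈p|e|⌉ vertices in every edge e (possible since p ≤ 1) and let S be the union of
-- these choices, so |S| ≤ Σ ⌈p|e|⌉.  Once S is on fire every edge reaches its threshold, and
-- as no vertex is isolated one propagation step burns everything: S is a lazy burning set.
-- In the burning game, use the vertices of S as sources one at a time, skipping those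
-- already on fire; one more round then finishes.  That is at most |S| + 1 rounds, and 2 when
-- S is empty, still within 1 + Σ ⌈p|e|⌉ since p > 0 and some edge is nonempty.
module Submission where

open import Defs
open import Data.Nat using (ℕ; suc)
open import Data.Rational using (ℚ; _<_; 0ℚ; 1ℚ)
open import Data.Product using (_×_)

open import Data.Bool using (if_then_else_)
open import Data.Bool.Properties using (T-≡)
open import Data.Empty using (⊥-elim)
open import Data.Fin using (Fin; zero; suc; fromℕ<)
open import Data.Fin.Subset
  using (Subset; inside; outside; ⁅_⁆; _∪_; _∩_; _∈_; _⊆_; ∣_∣; ⊤; ⊥; ∁)
open import Data.Fin.Subset.Properties
  using (⊆-antisym; ⊆⊤; ⊆-refl; p⊆p∪q; q⊆p∪q; x∈p∪q⁺; x∈p∩q⁺; x∈⁅x⁆; p⊆q⇒∣p∣≤∣q∣; ⊥⊆; _∈?_;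
         ∣⊥∣≡0; ∪-zeroˡ; nonempty?; x∈∁p⇒x∉p; x∉∁p⇒x∈p; x∈p⇒∣p-x∣<∣p∣)
open import Data.Integer as ℤ using (ℤ; +_; +0; -[1+_]; +[1+_]; 0ℤ; -_; _/ℕ_)
import Data.Integer.Properties as ℤ
open import Data.Integer.DivMod using (div-pos-is-/ℕ; [n/ℕd]*d≤n; n<s[n/ℕd]*d)
open import Data.Integer.Tactic.RingSolver using (solve-∀)
open import Data.List using (List; []; _∷_; foldr; map; length)
open import Data.List.Membership.Propositional renaming (_∈_ to _∈ₗ_)
open import Data.List.Properties using (length-map)
open import Data.List.Relation.Unary.All using (All; []; _∷_)
open import Data.List.Relation.Unary.Any as Any using (Any; here; there)
open import Data.List.Relation.Unary.Any.Properties using (map⁺; ¬Any[])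
open import Data.Nat as ℕ using (zero; z≤n; s≤s; _≤ᵇ_; _⊓_)
import Data.Nat.Properties as ℕ
open import Data.Nat.ListAction using (sum)
open import Data.Nat.Coprimality using (1-coprimeTo) renaming (sym to coprime-sym)
open import Data.Product using (∃; _,_)
open import Data.Rational as ℚ using (mkℚ; ↥_; ↧_; ↧ₙ_; ceiling; _/_; _*_)
import Data.Rational.Properties as ℚ
open import Data.Sum using (_⊎_; inj₁; inj₂; map₂)
open import Data.Vec using ([]; _∷_; here; there)
open import Function using (_∘_)
open import Function.Bundles using (Equivalence)
open import Relation.Nullary using (yes; no)
open import Relation.Binary.PropositionalEquality using (_≡_; refl; sym; trans; cong; subst)

private variable
  m : ℕ

ceiling≡-[-↥/↧] : ∀ q → ceiling q ≡ - ((- ↥ q) /ℕ ↧ₙ q)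
ceiling≡-[-↥/↧] q = trans (ceiling-by-/ q) (cong -_ (div-pos-is-/ℕ (- ↥ q) (↧ₙ q)))
  where
  ceiling-by-/ : ∀ q → ceiling q ≡ - ((- ↥ q) ℤ./ ↧ q)
  ceiling-by-/ (mkℚ -[1+ _ ] _ _) = refl
  ceiling-by-/ (mkℚ +0       _ _) = refl
  ceiling-by-/ (mkℚ +[1+ _ ] _ _) = refl

↥≤ceiling*↧ : ∀ q → ↥ q ℤ.≤ ceiling q ℤ.* ↧ q
↥≤ceiling*↧ q = begin
  ↥ q             ≡⟨ ℤ.neg-involutive (↥ q) ⟨
  - - ↥ q         ≤⟨ ℤ.neg-mono-≤ ([n/ℕd]*d≤n (- ↥ q) (↧ₙ q)) ⟩
  - (f ℤ.* d)     ≡⟨ ℤ.neg-distribˡ-* f d ⟩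
  - f ℤ.* d       ≡⟨ cong (ℤ._* d) (ceiling≡-[-↥/↧] q) ⟨
  ceiling q ℤ.* d ∎
  where
  open ℤ.≤-Reasoning
  d f : ℤ
  d = ↧ q
  f = (- ↥ q) /ℕ ↧ₙ q

ceiling*↧<↧+↥ : ∀ q → ceiling q ℤ.* ↧ q ℤ.< ↧ q ℤ.+ ↥ q
ceiling*↧<↧+↥ q = begin-strict
  ceiling q ℤ.* d            ≡⟨ cong (ℤ._* d) (ceiling≡-[-↥/↧] q) ⟩
  - f ℤ.* d                  ≡⟨ rearrange f d ⟩
  d ℤ.+ - (d ℤ.+ f ℤ.* d)    <⟨ ℤ.+-monoʳ-< d (ℤ.neg-mono-< -↥<d+f*d) ⟩
  d ℤ.+ - - ↥ q              ≡⟨ cong (ℤ._+_ d) (ℤ.neg-involutive (↥ q)) ⟩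
  d ℤ.+ ↥ q                  ∎
  where
  open ℤ.≤-Reasoning
  d f : ℤ
  d = ↧ q
  f = (- ↥ q) /ℕ ↧ₙ q
  -↥<d+f*d : - ↥ q ℤ.< d ℤ.+ f ℤ.* d
  -↥<d+f*d = subst (- ↥ q ℤ.<_) (ℤ.suc-* f d) (n<s[n/ℕd]*d (- ↥ q) (↧ₙ q))
  rearrange : ∀ f d → - f ℤ.* d ≡ d ℤ.+ - (d ℤ.+ f ℤ.* d)
  rearrange = solve-∀

i/1≡mkℚ : ∀ i → i / 1 ≡ mkℚ i 0 (coprime-sym (1-coprimeTo ℤ.∣ i ∣))
i/1≡mkℚ i = ℚ.↥p/↧p≡p (mkℚ i 0 _)

ceiling-≤ : ∀ q i → q ℚ.≤ i / 1 → ceiling q ℤ.≤ i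
ceiling-≤ q i q≤i = ℤ.≤-trans (ℤ.i<j⇒i≤pred[j] c<1+i) (ℤ.≤-reflexive (ℤ.pred-suc i))
  where
  open ℤ.≤-Reasoning
  d : ℤ
  d = ↧ q
  ↥q*1≤i*d : ↥ q ℤ.* + 1 ℤ.≤ i ℤ.* d
  ↥q*1≤i*d = ℚ.drop-*≤* (subst (q ℚ.≤_) (i/1≡mkℚ i) q≤i)
  c<1+i : ceiling q ℤ.< ℤ.suc i
  c<1+i = ℤ.*-cancelʳ-<-nonNeg d (begin-strict
    ceiling q ℤ.* d     <⟨ ceiling*↧<↧+↥ q ⟩
    d ℤ.+ ↥ q           ≡⟨ cong (ℤ._+_ d) (ℤ.*-identityʳ (↥ q)) ⟨
    d ℤ.+ ↥ q ℤ.* + 1   ≤⟨ ℤ.+-monoʳ-≤ d ↥q*1≤i*d ⟩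
    d ℤ.+ i ℤ.* d       ≡⟨ ℤ.suc-* i d ⟨
    ℤ.suc i ℤ.* d       ∎)

≤-ceiling : ∀ i q → i / 1 ℚ.≤ q → i ℤ.≤ ceiling q
≤-ceiling i q i≤q = ℤ.*-cancelʳ-≤-pos i (ceiling q) (↧ q) (begin
  i ℤ.* ↧ q           ≤⟨ ℚ.drop-*≤* (subst (ℚ._≤ q) (i/1≡mkℚ i) i≤q) ⟩
  ↥ q ℤ.* + 1         ≡⟨ ℤ.*-identityʳ (↥ q) ⟩
  ↥ q                 ≤⟨ ↥≤ceiling*↧ q ⟩
  ceiling q ℤ.* ↧ q   ∎)
  where open ℤ.≤-Reasoning

<-ceiling : ∀ i q → i / 1 ℚ.< q → i ℤ.< ceiling q
<-ceiling i q i<q = ℤ.*-cancelʳ-<-nonNeg (↧ q) (begin-strict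
  i ℤ.* ↧ q           <⟨ ℚ.drop-*<* (subst (ℚ._< q) (i/1≡mkℚ i) i<q) ⟩
  ↥ q ℤ.* + 1         ≡⟨ ℤ.*-identityʳ (↥ q) ⟩
  ↥ q                 ≤⟨ ↥≤ceiling*↧ q ⟩
  ceiling q ℤ.* ↧ q   ∎)
  where open ℤ.≤-Reasoning

thr≤ : ∀ {p} → 0ℚ ℚ.≤ p → p ℚ.≤ 1ℚ → ∀ k → thr p k ℕ.≤ k
thr≤ {p} 0≤p p≤1 k = ℤ.drop‿+≤+ (subst (ℤ._≤ + k) (sym (ℤ.0≤i⇒+∣i∣≡i 0≤c)) c≤k)
  where
  K : ℚ
  K = + k / 1
  instance
    _ : ℚ.NonNegative K
    _ = ℚ.normalize-nonNeg k 1
  0≤c : 0ℤ ℤ.≤ ceiling (p * K)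
  0≤c = ≤-ceiling 0ℤ (p * K) (subst (ℚ._≤ p * K) (ℚ.*-zeroˡ K) (ℚ.*-monoʳ-≤-nonNeg K 0≤p))
  c≤k : ceiling (p * K) ℤ.≤ + k
  c≤k = ceiling-≤ (p * K) (+ k) (subst (p * K ℚ.≤_) (ℚ.*-identityˡ K) (ℚ.*-monoʳ-≤-nonNeg K p≤1))

thr>0 : ∀ {p} → 0ℚ < p → ∀ {k} → 0 ℕ.< k → 0 ℕ.< thr p k
thr>0 {p} 0<p {suc k} _ = ℤ.drop‿+<+ (subst (0ℤ ℤ.<_) (sym (ℤ.0≤i⇒+∣i∣≡i (ℤ.<⇒≤ 0<c))) 0<c)
  where
  K : ℚ
  K = + suc k / 1
  instance
    _ : ℚ.Positive K
    _ = ℚ.normalize-pos (suc k) 1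
  0<c : 0ℤ ℤ.< ceiling (p * K)
  0<c = <-ceiling 0ℤ (p * K) (subst (ℚ._< p * K) (ℚ.*-zeroˡ K) (ℚ.*-monoˡ-<-pos K 0<p))

first : ℕ → Subset m → Subset m
first zero    s             = ⊥
first (suc k) []            = []
first (suc k) (outside ∷ s) = outside ∷ first (suc k) s
first (suc k) (inside ∷ s)  = inside ∷ first k s

first⊆ : ∀ k (s : Subset m) → first k s ⊆ s
first⊆ zero    s             = ⊥⊆
first⊆ (suc k) (outside ∷ s) (there x∈) = there (first⊆ (suc k) s x∈)
first⊆ (suc k) (inside ∷ s)  here       = here
first⊆ (suc k) (inside ∷ s)  (there x∈) = there (first⊆ k s x∈)

∣first∣≡⊓ : ∀ k (s : Subset m) → ∣ first k s ∣ ≡ k ⊓ ∣ s ∣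
∣first∣≡⊓ {m} zero s           = ∣⊥∣≡0 m
∣first∣≡⊓ (suc k) []            = refl
∣first∣≡⊓ (suc k) (outside ∷ s) = ∣first∣≡⊓ (suc k) s
∣first∣≡⊓ (suc k) (inside ∷ s)  = cong suc (∣first∣≡⊓ k s)

∣p∪q∣≤∣p∣+∣q∣ : ∀ (p q : Subset m) → ∣ p ∪ q ∣ ℕ.≤ ∣ p ∣ ℕ.+ ∣ q ∣
∣p∪q∣≤∣p∣+∣q∣ []            []            = z≤n
∣p∪q∣≤∣p∣+∣q∣ (outside ∷ p) (outside ∷ q) = ∣p∪q∣≤∣p∣+∣q∣ p q
∣p∪q∣≤∣p∣+∣q∣ (inside ∷ p)  (outside ∷ q) = s≤s (∣p∪q∣≤∣p∣+∣q∣ p q)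
∣p∪q∣≤∣p∣+∣q∣ (outside ∷ p) (inside ∷ q)  =
  subst (suc ∣ p ∪ q ∣ ℕ.≤_) (sym (ℕ.+-suc ∣ p ∣ ∣ q ∣)) (s≤s (∣p∪q∣≤∣p∣+∣q∣ p q))
∣p∪q∣≤∣p∣+∣q∣ (inside ∷ p)  (inside ∷ q)  =
  s≤s (ℕ.≤-trans (∣p∪q∣≤∣p∣+∣q∣ p q) (ℕ.+-monoʳ-≤ ∣ p ∣ (ℕ.n≤1+n ∣ q ∣)))

∀∈⇒≡⊤ : {p : Subset m} → (∀ x → x ∈ p) → p ≡ ⊤
∀∈⇒≡⊤ ∀∈p = ⊆-antisym ⊆⊤ (λ {x} _ → ∀∈p x)

elements : Subset m → List (Fin m)
elements []            = []
elements (inside ∷ s)  = zero ∷ map suc (elements s)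
elements (outside ∷ s) = map suc (elements s)

length-elements : ∀ (s : Subset m) → length (elements s) ≡ ∣ s ∣
length-elements []            = refl
length-elements (inside ∷ s)  = cong suc (trans (length-map suc (elements s)) (length-elements s))
length-elements (outside ∷ s) = trans (length-map suc (elements s)) (length-elements s)

∈-elements : ∀ {s : Subset m} {x} → x ∈ s → x ∈ₗ elements s
∈-elements {s = inside ∷ s}  here       = here refl
∈-elements {s = inside ∷ s}  (there x∈) = there (map⁺ (Any.map (cong suc) (∈-elements x∈)))
∈-elements {s = outside ∷ s} (there x∈) = map⁺ (Any.map (cong suc) (∈-elements x∈))

nonEmptyCover : Fin m → ∀ (s : Subset m) {k} → 0 ℕ.< k → ∣ s ∣ ℕ.≤ k →
                ∃ λ v → ∃ λ vs → (∀ {x} → x ∈ s → x ∈ₗ v ∷ vs) × suc (length vs) ℕ.≤ k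
nonEmptyCover x₀ s 0<k ∣s∣≤k with elements s in eq
... | [] = x₀ , [] , (λ x∈s → ⊥-elim (¬Any[] (subst (_ ∈ₗ_) eq (∈-elements x∈s)))) , 0<k
... | v ∷ vs = v , vs , (λ x∈s → subst (_ ∈ₗ_) eq (∈-elements x∈s)) ,
               subst (ℕ._≤ _) (trans (sym (length-elements s)) (cong length eq)) ∣s∣≤k

0<sum : ∀ {A : Set} (f : A → ℕ) {xs} → Any (λ x → 0 ℕ.< f x) xs → 0 ℕ.< sum (map f xs)
0<sum f (here 0<fx)   = ℕ.<-≤-trans 0<fx (ℕ.m≤m+n _ _)
0<sum f (there 0<fxs) = ℕ.<-≤-trans (0<sum f 0<fxs) (ℕ.m≤n+m _ _)

CatchesFire : (ℕ → ℕ) → Subset m → Subset m → Set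
CatchesFire t F e = t ∣ e ∣ ℕ.≤ ∣ e ∩ F ∣

ignited : (ℕ → ℕ) → Subset m → List (Subset m) → Subset m
ignited t F = foldr (λ e acc → if t ∣ e ∣ ≤ᵇ ∣ e ∩ F ∣ then e ∪ acc else acc) ⊥

spread≡∪ignited : ∀ p H F → spread p H F ≡ F ∪ ignited (thr p) F (edges H)
spread≡∪ignited p H F = refl

∈-ignited : ∀ t {F : Subset m} {es x} → All (CatchesFire t F) es → Any (x ∈_) es →
            x ∈ ignited t F es
∈-ignited t (catches ∷ all-catch) x∈es rewrite Equivalence.to T-≡ (ℕ.≤⇒≤ᵇ catches) =
  x∈p∪q⁺ (map₂ (∈-ignited t all-catch) (Any.toSum x∈es))

seed : (ℕ → ℕ) → List (Subset m) → Subset m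
seed t []       = ⊥
seed t (e ∷ es) = first (t ∣ e ∣) e ∪ seed t es

∣seed∣≤ : ∀ t (es : List (Subset m)) → ∣ seed t es ∣ ℕ.≤ sum (map (λ e → t ∣ e ∣) es)
∣seed∣≤ {m} t []       = ℕ.≤-reflexive (∣⊥∣≡0 m)
∣seed∣≤ t (e ∷ es) = ℕ.≤-trans (∣p∪q∣≤∣p∣+∣q∣ (first (t ∣ e ∣) e) (seed t es))
  (ℕ.+-mono-≤ (ℕ.≤-trans (ℕ.≤-reflexive (∣first∣≡⊓ (t ∣ e ∣) e)) (ℕ.m⊓n≤m _ _)) (∣seed∣≤ t es))

seed⊆⇒catchFire : ∀ {t} → (∀ k → t k ℕ.≤ k) → ∀ es {F : Subset m} → seed t es ⊆ F →
                  All (CatchesFire t F) es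
seed⊆⇒catchFire t≤ []       seed⊆F = []
seed⊆⇒catchFire {t = t} t≤ (e ∷ es) {F} seed⊆F =
  subst (ℕ._≤ ∣ e ∩ F ∣) ∣first∣≡t (p⊆q⇒∣p∣≤∣q∣ first⊆e∩F)
  ∷ seed⊆⇒catchFire t≤ es (seed⊆F ∘ q⊆p∪q _ _)
  where
  ∣first∣≡t : ∣ first (t ∣ e ∣) e ∣ ≡ t ∣ e ∣
  ∣first∣≡t = trans (∣first∣≡⊓ (t ∣ e ∣) e) (ℕ.m≤n⇒m⊓n≡m (t≤ ∣ e ∣))
  first⊆e∩F : first (t ∣ e ∣) e ⊆ e ∩ F
  first⊆e∩F x∈ = x∈p∩q⁺ (first⊆ (t ∣ e ∣) e x∈ , seed⊆F (p⊆p∪q _ x∈))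

spread-seed≡⊤ : ∀ {p} → 0ℚ ℚ.≤ p → p ℚ.≤ 1ℚ → ∀ H → NoIsolatedVertices H →
                ∀ {F} → seed (thr p) (edges H) ⊆ F → spread p H F ≡ ⊤
spread-seed≡⊤ {p} 0≤p p≤1 H no-isolated {F} seed⊆F = ∀∈⇒≡⊤ λ x →
  subst (x ∈_) (sym (spread≡∪ignited p H F))
    (q⊆p∪q F _ (∈-ignited (thr p) (seed⊆⇒catchFire (thr≤ 0≤p p≤1) (edges H) seed⊆F) (no-isolated x)))

module BurningGame (p : ℚ) (H : Hypergraph) (S : Subset (n H))
                   (spread≡⊤ : ∀ {F} → S ⊆ F → spread p H F ≡ ⊤) where

  Covers : Subset (n H) → List (Fin (n H)) → Set
  Covers F vs = ∀ {x} → x ∈ S → x ∈ F ⊎ x ∈ₗ vs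

  covers-step : ∀ {F F′ v vs} → F ⊆ F′ → v ∈ F′ → Covers F (v ∷ vs) → Covers F′ vs
  covers-step F⊆F′ v∈F′ covers x∈S with covers x∈S
  ... | inj₁ x∈F          = inj₁ (F⊆F′ x∈F)
  ... | inj₂ (here refl)  = inj₁ v∈F′
  ... | inj₂ (there x∈vs) = inj₂ x∈vs

  gameFrom : ∀ F vs → Covers F vs →
             ∃ λ us → GameFrom p H F us × length us ℕ.≤ suc (length vs)
  gameFrom F [] covers with nonempty? (∁ F)
  ... | no ∁F-empty =
    [] , ∀∈⇒≡⊤ (λ x → x∉∁p⇒x∈p (λ x∈∁F → ∁F-empty (x , x∈∁F))) , z≤n
  ... | yes (u , u∈∁F) =
    u ∷ [] , (x∈∁p⇒x∉p u∈∁F , trans (cong (_∪ ⁅ u ⁆) (spread≡⊤ S⊆F)) (∪-zeroˡ ⁅ u ⁆)) , s≤s z≤n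
    where
    S⊆F : S ⊆ F
    S⊆F x∈S with covers x∈S
    ... | inj₁ x∈F = x∈F
  gameFrom F (v ∷ vs) covers with v ∈? F
  ... | yes v∈F =
    let us , game , len = gameFrom F vs (covers-step ⊆-refl v∈F covers)
    in  us , game , ℕ.m≤n⇒m≤1+n len
  ... | no v∉F =
    let us , game , len = gameFrom F′ vs (covers-step (p⊆p∪q _ ∘ p⊆p∪q _) (q⊆p∪q _ _ (x∈⁅x⁆ v)) covers)
    in  v ∷ us , (v∉F , game) , s≤s len
    where
    F′ : Subset (n H)
    F′ = spread p H F ∪ ⁅ v ⁆

  burningNumber≤ : ∀ v vs {k} → (∀ {x} → x ∈ S → x ∈ₗ v ∷ vs) → suc (length vs) ℕ.≤ k →
                   BurningNumber≤ p H (suc k)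
  burningNumber≤ v vs S⊆v∷vs len≤k =
    let us , game , len = gameFrom ⁅ v ⁆ vs (covers-step ⊥⊆ (x∈⁅x⁆ v) (inj₂ ∘ S⊆v∷vs))
    in  v ∷ us , game , s≤s (ℕ.≤-trans len len≤k)

corollary2p17 : (H : Hypergraph) → NoIsolatedVertices H → (p : ℚ) → 0ℚ < p → p < 1ℚ →
    LazyBurningNumber≤ p H (ceilSum p H) × BurningNumber≤ p H (suc (ceilSum p H))
corollary2p17 H no-isolated p 0<p p<1 = (S , (1 , spread≡⊤ ⊆-refl) , ∣S∣≤) , burning
  where
  S : Subset (n H)
  S = seed (thr p) (edges H)
  ∣S∣≤ : ∣ S ∣ ℕ.≤ ceilSum p H
  ∣S∣≤ = ∣seed∣≤ (thr p) (edges H)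
  spread≡⊤ : ∀ {F} → S ⊆ F → spread p H F ≡ ⊤
  spread≡⊤ = spread-seed≡⊤ (ℚ.<⇒≤ 0<p) (ℚ.<⇒≤ p<1) H no-isolated
  x₀ : Fin (n H)
  x₀ = fromℕ< (nonempty H)
  0<ceilSum : 0 ℕ.< ceilSum p H
  0<ceilSum = 0<sum (λ e → thr p ∣ e ∣)
    (Any.map (λ x₀∈e → thr>0 0<p (ℕ.≤-<-trans z≤n (x∈p⇒∣p-x∣<∣p∣ x₀∈e))) (no-isolated x₀))
  burning : BurningNumber≤ p H (suc (ceilSum p H))
  burning =
    let v , vs , S⊆v∷vs , len = nonEmptyCover x₀ S 0<ceilSum ∣S∣≤
    in  BurningGame.burningNumber≤ p H S spread≡⊤ v vs S⊆v∷vs len
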